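{- For all $n\geq 1$, $$B_{n}^{neobc}=\frac{6s_{2n-1}+3t_{2n-1}+3}{2},\quad C_{n}^{neobc}=6s_{2n-1}+6t_{2n-1}+3,$$ $$R_{n}^{neobc}=\frac{3t_{2n-1}-1}{2},\quad CR_{n}^{neobc}=3s_{2n-1}.$$
   Context: Let $\alpha=1+\sqrt2$, $\beta=1-\sqrt2$. The square triangular numbers are $S_k=s_k^2=\frac{t_k(t_k+1)}{2}$, where $s_k=\frac{\alpha^{2k}-\beta^{2k}}{4\sqrt2}$ and $t_k=\frac{\alpha^{2k}+\beta^{2k}-2}{4}$ ($k\ge1$) are the sides of the corresponding square and triangle. A positive integer $m$ is a neo balcobalancing number if there is a positive integer $r$ (its neo balcobalancer) such that $(1+2+\cdots+(m-1))+(1+2+\cdots+m)=2[(m-1)+m+(m+1)+(m+2)+\cdots+(m+r)]$; then $r=\frac{ -2m-1+\sqrt{8m^2-12m+9}}{2}$. $B_n^{neobc}$ denotes the $n$-th neo balcobalancing number in increasing order ($n\ge1$), $R_n^{neobc}$ its neo balcobalancer, $C_n^{neobc}=\sqrt{8(B_n^{neobc})^2-12B_n^{neobc}+9}$ and $CR_n^{neobc}=\sqrt{2(R_n^{neobc})^2+5R_n^{neobc}+2}$. -}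

module Defs where

open import Data.Nat using (ℕ; zero; suc; _+_; _*_; _∸_; _/_; _<_; _≤_)
open import Data.Product using (_×_; _,_; Σ; ∃; proj₁; proj₂)
open import Relation.Binary.PropositionalEquality using (_≡_)
open import Relation.Nullary using (¬_)

-- Exact arithmetic in ℤ[√2]: α^(2k) = (3 + 2√2)^k = x_k + y_k √2 with x_k, y_k ∈ ℕ,
-- and β^(2k) = x_k - y_k √2 (conjugate).
alpha2pow : ℕ → ℕ × ℕ
alpha2pow zero = 1 , 0
alpha2pow (suc k) with alpha2pow k
... | x , y = 3 * x + 4 * y , 2 * x + 3 * y

-- s_k = (α^(2k) - β^(2k)) / (4√2) = (2 y_k √2) / (4√2) = y_k / 2   (exact: y_k is even)
s : ℕ → ℕ
s k = proj₂ (alpha2pow k) / 2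

-- t_k = (α^(2k) + β^(2k) - 2) / 4 = (2 x_k - 2) / 4 = (x_k - 1) / 2   (exact: x_k is odd)
t : ℕ → ℕ
t k = (proj₁ (alpha2pow k) ∸ 1) / 2

sumTo : ℕ → ℕ
sumTo zero = 0
sumTo (suc n) = suc n + sumTo n

rangeSum : ℕ → ℕ → ℕ
rangeSum a zero = a
rangeSum a (suc k) = a + rangeSum (suc a) k

IsNeoBalcobalancer : ℕ → ℕ → Set
IsNeoBalcobalancer m r =
  1 ≤ m × 1 ≤ r × sumTo (m ∸ 1) + sumTo m ≡ 2 * rangeSum (m ∸ 1) (suc r)

IsNeoBalcobalancing : ℕ → Set
IsNeoBalcobalancing m = Σ ℕ λ r → IsNeoBalcobalancer m r

data IsNth (P : ℕ → Set) : ℕ → ℕ → Set where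
  first : ∀ {m} → P m → (∀ k → k < m → ¬ P k) → IsNth P 1 m
  next  : ∀ {n m' m} → IsNth P n m' → m' < m → P m →
          (∀ k → m' < k → k < m → ¬ P k) → IsNth P (suc n) m

-- Writing m = B and r = R, the balance condition reads m² = (r + 2)(2m + r - 1), which turns into
-- the Pell equation X² + 9 = 2Y² for X = 4m - 3 and Y = 2m + 2r + 1 = C.  Multiplication by
-- α² = 3 + 2√2 preserves X² - 2Y², and its inverse lowers X while staying in ℕ for Y ≥ 7, so every
-- solution descends to (3, 3): the solutions are X_k + Y_k√2 = 3(1 + √2)α^(2k).  Since
-- t_k ≡ k (mod 2), X_k ≡ 1 (mod 4) exactly for odd k, and X_k increases with k, so B_n comes
-- from k = 2n - 1.  The formula for CR is the square triangular identity t_k(t_k + 1) = 2s_k².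

module Submission where

open import Defs
open import Data.Nat using (ℕ; zero; suc; _+_; _*_; _∸_; _≤_; _<_; z≤n; s≤s; z<s; _/_; _%_; _≤?_; _≟_)
open import Data.Nat.Properties
open import Data.Nat.DivMod using (m*n/n≡m; [m+kn]%n≡m%n)
open import Data.Nat.Induction using (<-rec)
open import Data.Nat.Tactic.RingSolver using (solve-∀)
open import Data.Fin using (Fin; toℕ; fromℕ<)
open import Data.Fin.Properties using (all?; toℕ-fromℕ<)
open import Data.Empty using (⊥-elim)
open import Data.Product using (_×_; Σ; ∃; ∃₂; _,_; proj₁; proj₂)
open import Data.Sum using (_⊎_; inj₁; inj₂)
open import Function.Base using (case_of_)
open import Function.Bundles using (_⇔_; mk⇔; Equivalence)
open import Function.Construct.Composition using (_⇔-∘_)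
open import Relation.Nullary using (yes; no)
open import Relation.Nullary.Decidable using (from-yes; _×-dec_; _→-dec_)
open import Relation.Binary.PropositionalEquality

m+o≡n+p∧o≡p⇒m≡n : ∀ {m n o p} → m + o ≡ n + p → o ≡ p → m ≡ n
m+o≡n+p∧o≡p⇒m≡n {m} {n} {o} e refl = +-cancelʳ-≡ o m n e

m+o≡n+p∧m≡n⇒o≡p : ∀ {m n o p} → m + o ≡ n + p → m ≡ n → o ≡ p
m+o≡n+p∧m≡n⇒o≡p {m} {n} {o} {p} e refl = +-cancelˡ-≡ m o p e

square-reflects-≤ : ∀ {m n} → m * m ≤ n * n → m ≤ n
square-reflects-≤ le = ≮⇒≥ λ n<m → <⇒≱ (*-mono-< n<m n<m) le

square-reflects-< : ∀ {m n} → m * m < n * n → m < n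
square-reflects-< lt = ≰⇒> λ n≤m → <⇒≱ lt (*-mono-≤ n≤m n≤m)

square-injective : ∀ {m n} → m * m ≡ n * n → m ≡ n
square-injective e = ≤-antisym (square-reflects-≤ (≤-reflexive e)) (square-reflects-≤ (≤-reflexive (sym e)))

halve : ∀ k x y → alpha2pow k ≡ (1 + 2 * x , 2 * y) → t k ≡ x × s k ≡ y
halve k x y eq rewrite eq = half x , half y
  where
  half : ∀ n → 2 * n / 2 ≡ n
  half n = trans (cong (_/ 2) (*-comm 2 n)) (m*n/n≡m n 2)

alpha2pow-suc : ∀ k x y → alpha2pow k ≡ (1 + 2 * x , 2 * y) →
                alpha2pow (suc k) ≡ (1 + 2 * (3 * x + 4 * y + 1) , 2 * (2 * x + 3 * y + 1))
alpha2pow-suc k x y eq rewrite eq = cong₂ _,_ (rational x y) (irrational x y)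
  where
  rational : ∀ x y → 3 * (1 + 2 * x) + 4 * (2 * y) ≡ 1 + 2 * (3 * x + 4 * y + 1)
  rational = solve-∀
  irrational : ∀ x y → 2 * (1 + 2 * x) + 3 * (2 * y) ≡ 2 * (2 * x + 3 * y + 1)
  irrational = solve-∀

alpha2pow≡ : ∀ k → alpha2pow k ≡ (1 + 2 * t k , 2 * s k)
t-s-suc : ∀ k → t (suc k) ≡ 3 * t k + 4 * s k + 1 × s (suc k) ≡ 2 * t k + 3 * s k + 1

alpha2pow≡ zero = refl
alpha2pow≡ (suc k) = trans (alpha2pow-suc k (t k) (s k) (alpha2pow≡ k))
  (sym (cong₂ (λ x y → (1 + 2 * x , 2 * y)) (proj₁ (t-s-suc k)) (proj₂ (t-s-suc k))))

t-s-suc k = halve (suc k) (3 * t k + 4 * s k + 1) (2 * t k + 3 * s k + 1)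
  (alpha2pow-suc k (t k) (s k) (alpha2pow≡ k))

t-suc : ∀ k → t (suc k) ≡ 3 * t k + 4 * s k + 1
t-suc k = proj₁ (t-s-suc k)

s-suc : ∀ k → s (suc k) ≡ 2 * t k + 3 * s k + 1
s-suc k = proj₂ (t-s-suc k)

square-triangular : ∀ k → t k * suc (t k) ≡ 2 * (s k * s k)
square-triangular zero = refl
square-triangular (suc k)
  rewrite t-suc k | s-suc k = m+o≡n+p∧o≡p⇒m≡n (invariant (t k) (s k)) (sym (square-triangular k))
  where
  invariant : ∀ x y → (3 * x + 4 * y + 1) * suc (3 * x + 4 * y + 1) + 2 * (y * y)
                    ≡ 2 * ((2 * x + 3 * y + 1) * (2 * x + 3 * y + 1)) + x * suc x
  invariant = solve-∀

t-even : ∀ j → ∃ λ p → t (2 * j) ≡ 2 * p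
t-odd : ∀ j → ∃ λ p → t (1 + 2 * j) ≡ 1 + 2 * p

t-even zero = 0 , refl
t-even (suc j) with t-odd j
... | p , t≡ = 2 + 3 * p + 2 * s (1 + 2 * j) , (begin
  t (2 * suc j)                                 ≡⟨ cong t (*-suc 2 j) ⟩
  t (suc (1 + 2 * j))                           ≡⟨ t-suc (1 + 2 * j) ⟩
  3 * t (1 + 2 * j) + 4 * s (1 + 2 * j) + 1     ≡⟨ cong (λ x → 3 * x + 4 * s (1 + 2 * j) + 1) t≡ ⟩
  3 * (1 + 2 * p) + 4 * s (1 + 2 * j) + 1       ≡⟨ regroup p (s (1 + 2 * j)) ⟩
  2 * (2 + 3 * p + 2 * s (1 + 2 * j))           ∎)
  where
  open ≡-Reasoning
  regroup : ∀ p y → 3 * (1 + 2 * p) + 4 * y + 1 ≡ 2 * (2 + 3 * p + 2 * y)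
  regroup = solve-∀

t-odd j with t-even j
... | p , t≡ = 3 * p + 2 * s (2 * j) , (begin
  t (1 + 2 * j)                         ≡⟨ t-suc (2 * j) ⟩
  3 * t (2 * j) + 4 * s (2 * j) + 1     ≡⟨ cong (λ x → 3 * x + 4 * s (2 * j) + 1) t≡ ⟩
  3 * (2 * p) + 4 * s (2 * j) + 1       ≡⟨ regroup p (s (2 * j)) ⟩
  1 + 2 * (3 * p + 2 * s (2 * j))       ∎)
  where
  open ≡-Reasoning
  regroup : ∀ p y → 3 * (2 * p) + 4 * y + 1 ≡ 1 + 2 * (3 * p + 2 * y)
  regroup = solve-∀

even-or-odd : ∀ k → (∃ λ j → k ≡ 2 * j) ⊎ (∃ λ j → k ≡ 1 + 2 * j)
even-or-odd zero = inj₁ (0 , refl)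
even-or-odd (suc k) with even-or-odd k
... | inj₁ (j , refl) = inj₂ (j , refl)
... | inj₂ (j , refl) = inj₁ (suc j , sym (*-suc 2 j))

Pell : ℕ → ℕ → Set
Pell X Y = X * X + 9 ≡ 2 * (Y * Y)

pellX pellY : ℕ → ℕ
pellX k = 3 + 6 * t k + 12 * s k
pellY k = 3 + 6 * t k + 6 * s k

pell-pellX-pellY : ∀ k → Pell (pellX k) (pellY k)
pell-pellX-pellY k =
  m+o≡n+p∧o≡p⇒m≡n (identity (t k) (s k)) (cong (36 *_) (square-triangular k))
  where
  identity : ∀ x y → (3 + 6 * x + 12 * y) * (3 + 6 * x + 12 * y) + 9 + 36 * (x * suc x)
                   ≡ 2 * ((3 + 6 * x + 6 * y) * (3 + 6 * x + 6 * y)) + 36 * (2 * (y * y))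
  identity = solve-∀

pellX-suc : ∀ k → pellX (suc k) ≡ 3 * pellX k + 4 * pellY k
pellX-suc k = begin
  3 + 6 * t (suc k) + 12 * s (suc k)
    ≡⟨ cong₂ (λ x y → 3 + 6 * x + 12 * y) (t-suc k) (s-suc k) ⟩
  3 + 6 * (3 * t k + 4 * s k + 1) + 12 * (2 * t k + 3 * s k + 1)
    ≡⟨ expand (t k) (s k) ⟩
  3 * pellX k + 4 * pellY k ∎
  where
  open ≡-Reasoning
  expand : ∀ x y → 3 + 6 * (3 * x + 4 * y + 1) + 12 * (2 * x + 3 * y + 1)
                 ≡ 3 * (3 + 6 * x + 12 * y) + 4 * (3 + 6 * x + 6 * y)
  expand = solve-∀

pellY-suc : ∀ k → pellY (suc k) ≡ 2 * pellX k + 3 * pellY k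
pellY-suc k = begin
  3 + 6 * t (suc k) + 6 * s (suc k)
    ≡⟨ cong₂ (λ x y → 3 + 6 * x + 6 * y) (t-suc k) (s-suc k) ⟩
  3 + 6 * (3 * t k + 4 * s k + 1) + 6 * (2 * t k + 3 * s k + 1)
    ≡⟨ expand (t k) (s k) ⟩
  2 * pellX k + 3 * pellY k ∎
  where
  open ≡-Reasoning
  expand : ∀ x y → 3 + 6 * (3 * x + 4 * y + 1) + 6 * (2 * x + 3 * y + 1)
                 ≡ 2 * (3 + 6 * x + 12 * y) + 3 * (3 + 6 * x + 6 * y)
  expand = solve-∀

pellX-increasing : ∀ k → pellX k < pellX (suc k)
pellX-increasing k = begin-strict
  pellX k                                     <⟨ m<m+n (pellX k) z<s ⟩
  pellX k + (2 * pellX k + 4 * pellY k)       ≡⟨ regroup (pellX k) (pellY k) ⟩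
  3 * pellX k + 4 * pellY k                   ≡⟨ sym (pellX-suc k) ⟩
  pellX (suc k)                               ∎
  where
  open ≤-Reasoning
  regroup : ∀ x y → x + (2 * x + 4 * y) ≡ 3 * x + 4 * y
  regroup = solve-∀

pell-unstep : ∀ x y → Pell (3 * x + 4 * y) (2 * x + 3 * y) → Pell x y
pell-unstep x y pell = sym (m+o≡n+p∧m≡n⇒o≡p (invariant x y) pell)
  where
  invariant : ∀ x y → (3 * x + 4 * y) * (3 * x + 4 * y) + 9 + 2 * (y * y)
                    ≡ 2 * ((2 * x + 3 * y) * (2 * x + 3 * y)) + (x * x + 9)
  invariant = solve-∀

pell⇒X<2Y : ∀ X Y → Pell X Y → X < 2 * Y
pell⇒X<2Y X Y pell = square-reflects-< (begin-strict
  X * X                       <⟨ m<m+n (X * X) z<s ⟩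
  X * X + 9                   ≡⟨ pell ⟩
  2 * (Y * Y)                 ≤⟨ m≤m+n (2 * (Y * Y)) (2 * (Y * Y)) ⟩
  2 * (Y * Y) + 2 * (Y * Y)   ≡⟨ expand Y ⟩
  2 * Y * (2 * Y)             ∎)
  where
  open ≤-Reasoning
  expand : ∀ y → 2 * (y * y) + 2 * (y * y) ≡ 2 * y * (2 * y)
  expand = solve-∀

pell⇒2X≤3Y : ∀ X Y → Pell X Y → 2 * X ≤ 3 * Y
pell⇒2X≤3Y X Y pell = square-reflects-≤ (begin
  2 * X * (2 * X)             ≤⟨ m≤m+n (2 * X * (2 * X)) 36 ⟩
  2 * X * (2 * X) + 36        ≡⟨ expand X ⟩
  4 * (X * X + 9)             ≡⟨ cong (4 *_) pell ⟩
  4 * (2 * (Y * Y))           ≤⟨ m≤m+n (4 * (2 * (Y * Y))) (Y * Y) ⟩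
  4 * (2 * (Y * Y)) + Y * Y   ≡⟨ expand′ Y ⟩
  3 * Y * (3 * Y)             ∎)
  where
  open ≤-Reasoning
  expand : ∀ x → 2 * x * (2 * x) + 36 ≡ 4 * (x * x + 9)
  expand = solve-∀
  expand′ : ∀ y → 4 * (2 * (y * y)) + y * y ≡ 3 * y * (3 * y)
  expand′ = solve-∀

pell⇒4Y≤3X : ∀ X Y → Pell X Y → 7 ≤ Y → 4 * Y ≤ 3 * X
pell⇒4Y≤3X X Y pell 7≤Y = square-reflects-≤ (begin
  4 * Y * (4 * Y)             ≡⟨ expand Y ⟩
  8 * (2 * (Y * Y))           ≡⟨ cong (8 *_) pell ⟨
  8 * (X * X + 9)             ≡⟨ expand′ X ⟩
  8 * (X * X) + 72            ≤⟨ +-monoʳ-≤ (8 * (X * X)) 72≤X² ⟩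
  8 * (X * X) + X * X         ≡⟨ expand″ X ⟩
  3 * X * (3 * X)             ∎)
  where
  open ≤-Reasoning
  72≤X² : 72 ≤ X * X
  72≤X² = ≤-trans (m≤m+n 72 17)
    (+-cancelʳ-≤ 9 89 (X * X) (≤-trans (*-monoʳ-≤ 2 (*-mono-≤ 7≤Y 7≤Y)) (≤-reflexive (sym pell))))
  expand : ∀ y → 4 * y * (4 * y) ≡ 8 * (2 * (y * y))
  expand = solve-∀
  expand′ : ∀ x → 8 * (x * x + 9) ≡ 8 * (x * x) + 72
  expand′ = solve-∀
  expand″ : ∀ x → 8 * (x * x) + x * x ≡ 3 * x * (3 * x)
  expand″ = solve-∀

pell-small : ∀ X Y → Y < 7 → Pell X Y → X ≡ 3 × Y ≡ 3
pell-small X Y Y<7 pell = subst₂ (λ x y → Pell x y → x ≡ 3 × y ≡ 3)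
  (toℕ-fromℕ< X<12) (toℕ-fromℕ< Y<7) (table (fromℕ< X<12) (fromℕ< Y<7)) pell
  where
  X<12 : X < 12
  X<12 = <-≤-trans (pell⇒X<2Y X Y pell) (*-monoʳ-≤ 2 (≤-pred Y<7))
  table : ∀ (x : Fin 12) (y : Fin 7) → Pell (toℕ x) (toℕ y) → toℕ x ≡ 3 × toℕ y ≡ 3
  table = from-yes (all? {n = 12} λ x → all? {n = 7} λ y →
    (toℕ x * toℕ x + 9 ≟ 2 * (toℕ y * toℕ y)) →-dec (toℕ x ≟ 3 ×-dec toℕ y ≟ 3))

automorphism-inverse : ∀ X Y x y → x + 4 * Y ≡ 3 * X → y + 2 * X ≡ 3 * Y →
                       X ≡ 3 * x + 4 * y × Y ≡ 2 * x + 3 * y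
automorphism-inverse X Y x y ex ey =
  sym (+-cancelʳ-≡ (8 * X + 12 * Y) (3 * x + 4 * y) X (begin
    3 * x + 4 * y + (8 * X + 12 * Y)   ≡⟨ regroupX x y X Y ⟩
    3 * (x + 4 * Y) + 4 * (y + 2 * X)  ≡⟨ cong₂ (λ u v → 3 * u + 4 * v) ex ey ⟩
    3 * (3 * X) + 4 * (3 * Y)          ≡⟨ regroupX′ X Y ⟩
    X + (8 * X + 12 * Y)               ∎)) ,
  sym (+-cancelʳ-≡ (6 * X + 8 * Y) (2 * x + 3 * y) Y (begin
    2 * x + 3 * y + (6 * X + 8 * Y)    ≡⟨ regroupY x y X Y ⟩
    2 * (x + 4 * Y) + 3 * (y + 2 * X)  ≡⟨ cong₂ (λ u v → 2 * u + 3 * v) ex ey ⟩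
    2 * (3 * X) + 3 * (3 * Y)          ≡⟨ regroupY′ X Y ⟩
    Y + (6 * X + 8 * Y)                ∎))
  where
  open ≡-Reasoning
  regroupX : ∀ x y X Y → 3 * x + 4 * y + (8 * X + 12 * Y) ≡ 3 * (x + 4 * Y) + 4 * (y + 2 * X)
  regroupX = solve-∀
  regroupX′ : ∀ X Y → 3 * (3 * X) + 4 * (3 * Y) ≡ X + (8 * X + 12 * Y)
  regroupX′ = solve-∀
  regroupY : ∀ x y X Y → 2 * x + 3 * y + (6 * X + 8 * Y) ≡ 2 * (x + 4 * Y) + 3 * (y + 2 * X)
  regroupY = solve-∀
  regroupY′ : ∀ X Y → 2 * (3 * X) + 3 * (3 * Y) ≡ Y + (6 * X + 8 * Y)
  regroupY′ = solve-∀

-- (x, y) = (3X - 4Y, 3Y - 2X), i.e. x + y√2 = (X + Y√2)(3 - 2√2).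
pell-descent : ∀ X Y → Pell X Y → 7 ≤ Y →
  ∃₂ λ x y → Pell x y × x < X × X ≡ 3 * x + 4 * y × Y ≡ 2 * x + 3 * y
pell-descent X Y pell 7≤Y =
  x , y , pell-unstep x y (subst₂ Pell X≡ Y≡ pell) , x<X , X≡ , Y≡
  where
  x y : ℕ
  x = 3 * X ∸ 4 * Y
  y = 3 * Y ∸ 2 * X
  x+4Y≡3X : x + 4 * Y ≡ 3 * X
  x+4Y≡3X = m∸n+n≡m (pell⇒4Y≤3X X Y pell 7≤Y)
  X≡ : X ≡ 3 * x + 4 * y
  X≡ = proj₁ (automorphism-inverse X Y x y x+4Y≡3X (m∸n+n≡m (pell⇒2X≤3Y X Y pell)))
  Y≡ : Y ≡ 2 * x + 3 * y
  Y≡ = proj₂ (automorphism-inverse X Y x y x+4Y≡3X (m∸n+n≡m (pell⇒2X≤3Y X Y pell)))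
  x<X : x < X
  x<X = +-cancelʳ-< (4 * Y) x X (begin-strict
    x + 4 * Y        ≡⟨ x+4Y≡3X ⟩
    3 * X            ≡⟨ regroup X ⟩
    X + 2 * X        <⟨ +-monoʳ-< X (*-monoʳ-< 2 (pell⇒X<2Y X Y pell)) ⟩
    X + 2 * (2 * Y)  ≡⟨ cong (X +_) (regroup′ Y) ⟩
    X + 4 * Y        ∎)
    where
    open ≤-Reasoning
    regroup : ∀ X → 3 * X ≡ X + 2 * X
    regroup = solve-∀
    regroup′ : ∀ Y → 2 * (2 * Y) ≡ 4 * Y
    regroup′ = solve-∀

pellX-pellY-suc : ∀ X Y x y k → X ≡ 3 * x + 4 * y → Y ≡ 2 * x + 3 * y →
  x ≡ pellX k → y ≡ pellY k → X ≡ pellX (suc k) × Y ≡ pellY (suc k)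
pellX-pellY-suc X Y x y k X≡ Y≡ refl refl = trans X≡ (sym (pellX-suc k)) , trans Y≡ (sym (pellY-suc k))

PellClassified : ℕ → Set
PellClassified X = ∀ Y → Pell X Y → ∃ λ k → X ≡ pellX k × Y ≡ pellY k

pell-classification : ∀ X → PellClassified X
pell-classification = <-rec PellClassified descend
  where
  descend : ∀ X → (∀ {x} → x < X → PellClassified x) → PellClassified X
  descend X smaller Y pell with 7 ≤? Y
  ... | no Y≱7 = 0 , pell-small X Y (≰⇒> Y≱7) pell
  ... | yes 7≤Y = case pell-descent X Y pell 7≤Y of λ where
    (x , y , pell′ , x<X , X≡ , Y≡) → case smaller x<X y pell′ of λ where
      (k , x≡ , y≡) → suc k , pellX-pellY-suc X Y x y k X≡ Y≡ x≡ y≡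

sumTo-consecutive : ∀ n → sumTo n + sumTo (suc n) ≡ suc n * suc n
sumTo-consecutive zero = refl
sumTo-consecutive (suc n) = begin
  sumTo (suc n) + (suc (suc n) + sumTo (suc n))   ≡⟨ regroup (suc n) (sumTo n) (sumTo (suc n)) ⟩
  (suc n + suc (suc n)) + (sumTo n + sumTo (suc n)) ≡⟨ cong (suc n + suc (suc n) +_) (sumTo-consecutive n) ⟩
  (suc n + suc (suc n)) + suc n * suc n           ≡⟨ square (suc n) ⟩
  suc (suc n) * suc (suc n)                        ∎
  where
  open ≡-Reasoning
  regroup : ∀ m a b → (m + a) + (suc m + b) ≡ (m + suc m) + (a + b)
  regroup = solve-∀
  square : ∀ m → (m + suc m) + m * m ≡ suc m * suc m
  square = solve-∀

2*rangeSum : ∀ a k → 2 * rangeSum a k ≡ suc k * (2 * a + k)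
2*rangeSum a zero = sym (trans (*-identityˡ (2 * a + 0)) (+-identityʳ (2 * a)))
2*rangeSum a (suc k) = begin
  2 * (a + rangeSum (suc a) k)          ≡⟨ *-distribˡ-+ 2 a (rangeSum (suc a) k) ⟩
  2 * a + 2 * rangeSum (suc a) k        ≡⟨ cong (2 * a +_) (2*rangeSum (suc a) k) ⟩
  2 * a + suc k * (2 * suc a + k)       ≡⟨ expand a k ⟩
  suc (suc k) * (2 * a + suc k)         ∎
  where
  open ≡-Reasoning
  expand : ∀ a k → 2 * a + suc k * (2 * suc a + k) ≡ suc (suc k) * (2 * a + suc k)
  expand = solve-∀

balance⇔square : ∀ m₀ r →
  sumTo m₀ + sumTo (suc m₀) ≡ 2 * rangeSum m₀ (suc r) ⇔ suc m₀ * suc m₀ ≡ (2 + r) * (2 * m₀ + suc r)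
balance⇔square m₀ r = mk⇔
  (subst₂ _≡_ (sumTo-consecutive m₀) (2*rangeSum m₀ (suc r)))
  (subst₂ _≡_ (sym (sumTo-consecutive m₀)) (sym (2*rangeSum m₀ (suc r))))

square⇔pell : ∀ m₀ r →
  suc m₀ * suc m₀ ≡ (2 + r) * (2 * m₀ + suc r) ⇔ Pell (4 * m₀ + 1) (2 * r + 2 * m₀ + 3)
square⇔pell m₀ r = mk⇔
  (λ square → m+o≡n+p∧o≡p⇒m≡n (identity m₀ r) (cong (8 *_) (sym square)))
  (λ pell → *-cancelˡ-≡ _ _ 8 (sym (m+o≡n+p∧m≡n⇒o≡p (identity m₀ r) pell)))
  where
  identity : ∀ m r → (4 * m + 1) * (4 * m + 1) + 9 + 8 * ((2 + r) * (2 * m + suc r))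
                   ≡ 2 * ((2 * r + 2 * m + 3) * (2 * r + 2 * m + 3)) + 8 * (suc m * suc m)
  identity = solve-∀

neoBalcobalancer⇔pell : ∀ m₀ r →
  IsNeoBalcobalancer (suc m₀) r ⇔ (1 ≤ r × Pell (4 * m₀ + 1) (2 * r + 2 * m₀ + 3))
neoBalcobalancer⇔pell m₀ r = mk⇔
  (λ (_ , 1≤r , balance) → 1≤r , Equivalence.to balance⇔pell balance)
  (λ (1≤r , pell) → s≤s z≤n , 1≤r , Equivalence.from balance⇔pell pell)
  where
  balance⇔pell = square⇔pell m₀ r ⇔-∘ balance⇔square m₀ r

neoBalcobalancer-unique : ∀ {m r r′} → IsNeoBalcobalancer m r → IsNeoBalcobalancer m r′ → r ≡ r′
neoBalcobalancer-unique {zero} (() , _) _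
neoBalcobalancer-unique {suc m₀} {r} {r′} bal bal′ =
  *-cancelˡ-≡ r r′ 2 (+-cancelʳ-≡ (2 * m₀) (2 * r) (2 * r′) (+-cancelʳ-≡ 3 _ _ Y≡Y′))
  where
  Y≡Y′ : 2 * r + 2 * m₀ + 3 ≡ 2 * r′ + 2 * m₀ + 3
  Y≡Y′ = square-injective (*-cancelˡ-≡ _ _ 2 (trans
    (sym (proj₂ (Equivalence.to (neoBalcobalancer⇔pell m₀ r) bal)))
    (proj₂ (Equivalence.to (neoBalcobalancer⇔pell m₀ r′) bal′))))

halfT : ℕ → ℕ
halfT j = proj₁ (t-odd j)

t-odd≡ : ∀ j → t (1 + 2 * j) ≡ 1 + 2 * halfT j
t-odd≡ j = proj₂ (t-odd j)

-- neoB j and neoR j are B_(j+1) and R_(j+1); neoB j reduces to suc (neoB j ∸ 1).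
neoB neoR : ℕ → ℕ
neoB j = 3 + 3 * s (1 + 2 * j) + 3 * halfT j
neoR j = 1 + 3 * halfT j

pellX-odd : ∀ j → pellX (1 + 2 * j) ≡ 4 * (neoB j ∸ 1) + 1
pellX-odd j = begin
  3 + 6 * t (1 + 2 * j) + 12 * s (1 + 2 * j)      ≡⟨ cong (λ x → 3 + 6 * x + 12 * s (1 + 2 * j)) (t-odd≡ j) ⟩
  3 + 6 * (1 + 2 * halfT j) + 12 * s (1 + 2 * j)  ≡⟨ regroup (halfT j) (s (1 + 2 * j)) ⟩
  4 * (2 + 3 * s (1 + 2 * j) + 3 * halfT j) + 1   ∎
  where
  open ≡-Reasoning
  regroup : ∀ p y → 3 + 6 * (1 + 2 * p) + 12 * y ≡ 4 * (2 + 3 * y + 3 * p) + 1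
  regroup = solve-∀

pellY-odd : ∀ j → pellY (1 + 2 * j) ≡ 2 * neoR j + 2 * (neoB j ∸ 1) + 3
pellY-odd j = begin
  3 + 6 * t (1 + 2 * j) + 6 * s (1 + 2 * j)       ≡⟨ cong (λ x → 3 + 6 * x + 6 * s (1 + 2 * j)) (t-odd≡ j) ⟩
  3 + 6 * (1 + 2 * halfT j) + 6 * s (1 + 2 * j)   ≡⟨ regroup (halfT j) (s (1 + 2 * j)) ⟩
  2 * (1 + 3 * halfT j) + 2 * (2 + 3 * s (1 + 2 * j) + 3 * halfT j) + 3 ∎
  where
  open ≡-Reasoning
  regroup : ∀ p y → 3 + 6 * (1 + 2 * p) + 6 * y ≡ 2 * (1 + 3 * p) + 2 * (2 + 3 * y + 3 * p) + 3
  regroup = solve-∀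

neoB-isNeoBalcobalancer : ∀ j → IsNeoBalcobalancer (neoB j) (neoR j)
neoB-isNeoBalcobalancer j = Equivalence.from (neoBalcobalancer⇔pell (neoB j ∸ 1) (neoR j))
  (s≤s z≤n , subst₂ Pell (pellX-odd j) (pellY-odd j) (pell-pellX-pellY (1 + 2 * j)))

pellX-even : ∀ j → ∃ λ c → pellX (2 * j) ≡ 3 + c * 4
pellX-even j with t-even j
... | p , t≡ = 3 * p + 3 * s (2 * j) , (begin
  3 + 6 * t (2 * j) + 12 * s (2 * j)    ≡⟨ cong (λ x → 3 + 6 * x + 12 * s (2 * j)) t≡ ⟩
  3 + 6 * (2 * p) + 12 * s (2 * j)      ≡⟨ regroup p (s (2 * j)) ⟩
  3 + (3 * p + 3 * s (2 * j)) * 4       ∎)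
  where
  open ≡-Reasoning
  regroup : ∀ p y → 3 + 6 * (2 * p) + 12 * y ≡ 3 + (3 * p + 3 * y) * 4
  regroup = solve-∀

1+m*4≢3+n*4 : ∀ m n → 1 + m * 4 ≢ 3 + n * 4
1+m*4≢3+n*4 m n e with trans (sym ([m+kn]%n≡m%n 1 m 4)) (trans (cong (_% 4) e) ([m+kn]%n≡m%n 3 n 4))
... | ()

pellX≢4m+1 : ∀ m₀ j → 4 * m₀ + 1 ≢ pellX (2 * j)
pellX≢4m+1 m₀ j X≡ = 1+m*4≢3+n*4 m₀ c (begin
  1 + m₀ * 4     ≡⟨ cong (1 +_) (*-comm m₀ 4) ⟩
  1 + 4 * m₀     ≡⟨ +-comm 1 (4 * m₀) ⟩
  4 * m₀ + 1     ≡⟨ X≡ ⟩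
  pellX (2 * j)  ≡⟨ proj₂ (pellX-even j) ⟩
  3 + c * 4      ∎)
  where
  open ≡-Reasoning
  c : ℕ
  c = proj₁ (pellX-even j)

pellX≡4m+1⇒neoB : ∀ m₀ k → 4 * m₀ + 1 ≡ pellX k → ∃ λ j → suc m₀ ≡ neoB j
pellX≡4m+1⇒neoB m₀ k X≡ = case even-or-odd k of λ where
  (inj₁ (j , k≡2j))   → ⊥-elim (pellX≢4m+1 m₀ j (trans X≡ (cong pellX k≡2j)))
  (inj₂ (j , k≡1+2j)) → j , cong suc (*-cancelˡ-≡ m₀ (neoB j ∸ 1) 4
    (+-cancelʳ-≡ 1 (4 * m₀) (4 * (neoB j ∸ 1)) (trans X≡ (trans (cong pellX k≡1+2j) (pellX-odd j)))))

neoBalcobalancing⇒neoB : ∀ m → IsNeoBalcobalancing m → ∃ λ j → m ≡ neoB j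
neoBalcobalancing⇒neoB zero (_ , () , _)
neoBalcobalancing⇒neoB (suc m₀) (r , bal) =
  pellX≡4m+1⇒neoB m₀ (proj₁ classified) (proj₁ (proj₂ classified))
  where
  classified : ∃ λ k → 4 * m₀ + 1 ≡ pellX k × 2 * r + 2 * m₀ + 3 ≡ pellY k
  classified = pell-classification (4 * m₀ + 1) (2 * r + 2 * m₀ + 3)
    (proj₂ (Equivalence.to (neoBalcobalancer⇔pell m₀ r) bal))

neoB-increasing : ∀ j → neoB j < neoB (suc j)
neoB-increasing j = *-cancelˡ-< 4 (neoB j) (neoB (suc j)) (begin-strict
  4 * neoB j                          ≡⟨ 4*neoB j ⟩
  pellX (1 + 2 * j) + 3               <⟨ +-monoˡ-< 3 (<-trans (pellX-increasing (1 + 2 * j))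
                                                                (pellX-increasing (suc (1 + 2 * j)))) ⟩
  pellX (suc (suc (1 + 2 * j))) + 3   ≡⟨ cong (λ k → pellX (suc k) + 3) (*-suc 2 j) ⟨
  pellX (1 + 2 * suc j) + 3           ≡⟨ 4*neoB (suc j) ⟨
  4 * neoB (suc j)                    ∎)
  where
  open ≤-Reasoning
  4*neoB : ∀ j → 4 * neoB j ≡ pellX (1 + 2 * j) + 3
  4*neoB j = trans (regroup (neoB j ∸ 1)) (cong (_+ 3) (sym (pellX-odd j)))
    where
    regroup : ∀ m → 4 * suc m ≡ 4 * m + 1 + 3
    regroup = solve-∀

isNth-enumeration : ∀ {P : ℕ → Set} (f : ℕ → ℕ) → (∀ j → f j < f (suc j)) →
  (∀ j → P (f j)) → (∀ m → P m → ∃ λ j → m ≡ f j) → ∀ j → IsNth P (suc j) (f j)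
isNth-enumeration {P} f increasing inP onlyP = nth
  where
  monotone : ∀ {i j} → i ≤ j → f i ≤ f j
  monotone {j = zero} z≤n = ≤-refl
  monotone {j = suc j} i≤1+j with m≤n⇒m<n∨m≡n i≤1+j
  ... | inj₁ (s≤s i≤j) = ≤-trans (monotone i≤j) (<⇒≤ (increasing j))
  ... | inj₂ refl = ≤-refl
  reflects-< : ∀ {i j} → f i < f j → i < j
  reflects-< lt = ≰⇒> λ j≤i → <⇒≱ lt (monotone j≤i)
  nth : ∀ j → IsNth P (suc j) (f j)
  nth zero = first (inP 0) λ m m<f0 Pm → case onlyP m Pm of λ where
    (i , refl) → <⇒≱ (reflects-< m<f0) z≤n
  nth (suc j) = next (nth j) (increasing j) (inP (suc j)) λ m above below Pm → case onlyP m Pm of λ where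
    (i , refl) → <⇒≱ (reflects-< above) (≤-pred (reflects-< below))

2*neoB : ∀ j → 2 * neoB j ≡ 6 * s (1 + 2 * j) + 3 * t (1 + 2 * j) + 3
2*neoB j = trans (regroup (s (1 + 2 * j)) (halfT j))
  (cong (λ x → 6 * s (1 + 2 * j) + 3 * x + 3) (sym (t-odd≡ j)))
  where
  regroup : ∀ y p → 2 * (3 + 3 * y + 3 * p) ≡ 6 * y + 3 * (1 + 2 * p) + 3
  regroup = solve-∀

pell⇒Y²+12m≡8m²+9 : ∀ m₀ Y → Pell (4 * m₀ + 1) Y → Y * Y + 12 * suc m₀ ≡ 8 * suc m₀ * suc m₀ + 9
pell⇒Y²+12m≡8m²+9 m₀ Y pell = *-cancelˡ-≡ _ _ 2 (begin
  2 * (Y * Y + 12 * suc m₀)                         ≡⟨ regroup m₀ Y ⟩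
  2 * (Y * Y) + 24 * suc m₀                         ≡⟨ cong (_+ 24 * suc m₀) pell ⟨
  (4 * m₀ + 1) * (4 * m₀ + 1) + 9 + 24 * suc m₀     ≡⟨ expand m₀ ⟩
  2 * (8 * suc m₀ * suc m₀ + 9)                     ∎)
  where
  open ≡-Reasoning
  regroup : ∀ m y → 2 * (y * y + 12 * suc m) ≡ 2 * (y * y) + 24 * suc m
  regroup = solve-∀
  expand : ∀ m → (4 * m + 1) * (4 * m + 1) + 9 + 24 * suc m ≡ 2 * (8 * suc m * suc m + 9)
  expand = solve-∀

neoB-C : ∀ j → let C = 6 * s (1 + 2 * j) + 6 * t (1 + 2 * j) + 3 in
  C * C + 12 * neoB j ≡ 8 * neoB j * neoB j + 9
neoB-C j = subst (λ C → C * C + 12 * neoB j ≡ 8 * neoB j * neoB j + 9)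
  (regroup (t (1 + 2 * j)) (s (1 + 2 * j)))
  (pell⇒Y²+12m≡8m²+9 (neoB j ∸ 1) (pellY (1 + 2 * j))
    (subst (λ X → Pell X (pellY (1 + 2 * j))) (pellX-odd j) (pell-pellX-pellY (1 + 2 * j))))
  where
  regroup : ∀ x y → 3 + 6 * x + 6 * y ≡ 6 * y + 6 * x + 3
  regroup = solve-∀

2*neoR+1 : ∀ j → 2 * neoR j + 1 ≡ 3 * t (1 + 2 * j)
2*neoR+1 j = trans (regroup (halfT j)) (cong (3 *_) (sym (t-odd≡ j)))
  where
  regroup : ∀ p → 2 * (1 + 3 * p) + 1 ≡ 3 * (1 + 2 * p)
  regroup = solve-∀

-- CR² = (2R + 1)(R + 2) = 9 t (t + 1) / 2 = 9 s².
neoR-CR : ∀ j → 3 * s (1 + 2 * j) * (3 * s (1 + 2 * j)) ≡ 2 * neoR j * neoR j + 5 * neoR j + 2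
neoR-CR j = *-cancelˡ-≡ _ _ 2 (begin
  2 * (3 * s k * (3 * s k))                 ≡⟨ regroup (s k) ⟩
  9 * (2 * (s k * s k))                     ≡⟨ cong (9 *_) (square-triangular k) ⟨
  9 * (t k * suc (t k))                     ≡⟨ cong (λ x → 9 * (x * suc x)) (t-odd≡ j) ⟩
  9 * ((1 + 2 * p) * suc (1 + 2 * p))       ≡⟨ expand p ⟩
  2 * (2 * neoR j * neoR j + 5 * neoR j + 2) ∎)
  where
  open ≡-Reasoning
  k p : ℕ
  k = 1 + 2 * j
  p = halfT j
  regroup : ∀ y → 2 * (3 * y * (3 * y)) ≡ 9 * (2 * (y * y))
  regroup = solve-∀
  expand : ∀ p → 9 * ((1 + 2 * p) * suc (1 + 2 * p)) ≡ 2 * (2 * (1 + 3 * p) * (1 + 3 * p) + 5 * (1 + 3 * p) + 2)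
  expand = solve-∀

neoBalcobalancer-formulas : ∀ j r → IsNeoBalcobalancer (neoB j) r →
  2 * r + 1 ≡ 3 * t (1 + 2 * j) × 3 * s (1 + 2 * j) * (3 * s (1 + 2 * j)) ≡ 2 * r * r + 5 * r + 2
neoBalcobalancer-formulas j r bal =
  subst (λ r → 2 * r + 1 ≡ 3 * t (1 + 2 * j) × 3 * s (1 + 2 * j) * (3 * s (1 + 2 * j)) ≡ 2 * r * r + 5 * r + 2)
    (neoBalcobalancer-unique (neoB-isNeoBalcobalancer j) bal) (2*neoR+1 j , neoR-CR j)

theorem6p2 : (n : ℕ) → 1 ≤ n →
    Σ ℕ λ B →
      IsNth IsNeoBalcobalancing n B
      × 2 * B ≡ 6 * s (2 * n ∸ 1) + 3 * t (2 * n ∸ 1) + 3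
      × (6 * s (2 * n ∸ 1) + 6 * t (2 * n ∸ 1) + 3) * (6 * s (2 * n ∸ 1) + 6 * t (2 * n ∸ 1) + 3) + 12 * B
          ≡ 8 * B * B + 9
      × ((r : ℕ) → IsNeoBalcobalancer B r →
           2 * r + 1 ≡ 3 * t (2 * n ∸ 1)
           × (3 * s (2 * n ∸ 1)) * (3 * s (2 * n ∸ 1)) ≡ 2 * r * r + 5 * r + 2)
theorem6p2 zero ()
theorem6p2 (suc j) _ rewrite cong (_∸ 1) (*-suc 2 j) =
  neoB j ,
  isNth-enumeration neoB neoB-increasing (λ i → neoR i , neoB-isNeoBalcobalancer i) neoBalcobalancing⇒neoB j ,
  2*neoB j ,
  neoB-C j ,
  neoBalcobalancer-formulas j
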